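{- Let $a$ and $b$ be positive integers with $a>b$, let $\beta$ be an integer, and let $p$ be a prime not dividing $a$. Then there are infinitely many positive integers $n$ such that $\binom{an}{bn+\beta}\equiv \pm 1 \pmod p$. -}

module Defs where

open import Data.Nat using (ℕ)
open import Data.Nat.Combinatorics using (_C_)
open import Data.Integer using (ℤ; +_; -[1+_])

-- Binomial coefficient C(m, k) with natural top m and integer bottom k,
-- using the standard convention C(m, k) = 0 for k < 0 (and, via the
-- library's _C_, also for k > m).
binomℤ : ℕ → ℤ → ℕ
binomℤ m (+ k)     = m C k
binomℤ m -[1+ k ]  = 0

-- The proof follows the classical observation that every binomial coefficient
-- C(p^e − 1, m) with 0 ≤ m ≤ p^e − 1 is congruent to (−1)^m, hence to ±1,
-- modulo p.  It therefore suffices to find infinitely many n for which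
-- a·n + 1 is a power of p; then C(an, bn + β) is such a coefficient as soon
-- as n ≥ |β| (so that 0 ≤ bn + β ≤ an).
module Submission where

module PrimePowerBinomials where

  open import Defs using (binomℤ)
  open import Data.Nat
  open import Data.Nat.Properties
  open import Data.Nat.Combinatorics using (_C_; nCk+nC[k+1]≡[n+1]C[k+1]; k>n⇒nCk≡0; nC1≡n)
  open import Data.Nat.Divisibility
  open import Data.Nat.DivMod using (_%_; _/_; m≡m%n+[m/n]*n; m%n<n)
  open import Data.Nat.Primality using (Prime; euclidsLemma; prime⇒nonZero; prime⇒nonTrivial; prime⇒irreducible)
  open import Data.Nat.Coprimality using (Coprime; coprime-divisor)
  open import Data.Nat.Tactic.RingSolver using (solve-∀)
  open import Data.Fin using (Fin; toℕ; fromℕ<)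
  open import Data.Fin.Properties using (pigeonhole; toℕ-fromℕ<)
  open import Data.Integer as ℤ using (ℤ; +_; -[1+_])
  open import Data.Integer.Properties using (⊖-≥)
  import Data.Integer.Divisibility.Signed as ℤ∣
  import Data.Integer.Tactic.RingSolver as ℤ-Solver
  open import Data.Product using (∃; _×_; _,_)
  open import Data.Sum using (_⊎_; inj₁; inj₂)
  open import Data.Empty using (⊥-elim)
  open import Relation.Nullary using (¬_)
  open import Relation.Binary.PropositionalEquality

  absorption : ∀ n k → suc k * (suc n C suc k) ≡ suc n * (n C k)
  absorption zero zero = refl
  absorption zero (suc k)
    rewrite k>n⇒nCk≡0 {1} {suc (suc k)} (s≤s (s≤s z≤n)) | k>n⇒nCk≡0 {0} {suc k} (s≤s z≤n)
    = *-zeroʳ (suc (suc k))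
  absorption (suc n) zero
    rewrite nC1≡n (suc (suc n)) = cong (λ u → 2 + u) (trans (+-identityʳ n) (sym (*-identityʳ n)))
  absorption (suc n) (suc k) = begin
    (2 + k) * (suc N C suc (suc k))              ≡⟨ cong ((2 + k) *_) (sym (nCk+nC[k+1]≡[n+1]C[k+1] N (suc k))) ⟩
    (2 + k) * (A + B)                            ≡⟨ *-distribˡ-+ (2 + k) A B ⟩
    (A + (1 + k) * A) + (2 + k) * B              ≡⟨ +-assoc A ((1 + k) * A) _ ⟩
    A + ((1 + k) * A + (2 + k) * B)              ≡⟨ cong₂ (λ u v → A + (u + v)) (absorption n k) (absorption n (suc k)) ⟩
    A + (N * (n C k) + N * (n C suc k))          ≡⟨ cong (λ u → A + u) (sym (*-distribˡ-+ N (n C k) (n C suc k))) ⟩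
    A + N * (n C k + n C suc k)                  ≡⟨ cong (λ u → A + N * u) (nCk+nC[k+1]≡[n+1]C[k+1] n k) ⟩
    A + N * A                                    ∎
    where
    open ≡-Reasoning
    N = suc n
    A = N C suc k
    B = N C suc (suc k)

  -- If p^e divides j·c for some 0 < j < p^e, then p divides c: the factor j
  -- can absorb fewer than e factors p.
  prime-power-∣-product : ∀ {p} → Prime p → ∀ e j c → 0 < j → j < p ^ e → p ^ e ∣ j * c → p ∣ c
  prime-power-∣-product pr zero zero    c () _ _
  prime-power-∣-product pr zero (suc j) c _ (s≤s ()) _
  prime-power-∣-product {p} pr (suc e) j c 0<j j<pᵉ⁺¹ pᵉ⁺¹∣jc
    with euclidsLemma j c pr (∣-trans (n∣m*n (p ^ e)) (subst (_∣ j * c) (*-comm p (p ^ e)) pᵉ⁺¹∣jc))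
  ... | inj₂ p∣c = p∣c
  ... | inj₁ (divides (suc j′) refl) =
    prime-power-∣-product pr e (suc j′) c z<s j′<pᵉ (*-cancelˡ-∣ p (subst (p * p ^ e ∣_) (reassoc (suc j′) p c) pᵉ⁺¹∣jc))
    where
    instance _ = prime⇒nonZero pr
    reassoc : ∀ x y z → x * y * z ≡ y * (x * z)
    reassoc = solve-∀
    j′<pᵉ : suc j′ < p ^ e
    j′<pᵉ = *-cancelʳ-< p (suc j′) (p ^ e) (subst (suc j′ * p <_) (*-comm p (p ^ e)) j<pᵉ⁺¹)

  prime∣binomial : ∀ {p e n m} → Prime p → suc n ≡ p ^ e → m < n → p ∣ suc n C suc m
  prime∣binomial {p} {e} {n} {m} pr n+1≡pᵉ m<n =
    prime-power-∣-product pr e (suc m) (suc n C suc m) z<s (subst (suc m <_) n+1≡pᵉ (s≤s m<n))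
      (subst (p ^ e ∣_) (sym (absorption n m)) (subst (_∣ suc n * (n C m)) n+1≡pᵉ (m∣m*n (n C m))))

  infix 4 _≡±1-mod_
  _≡±1-mod_ : ℤ → ℕ → Set
  x ≡±1-mod p = (+ p ℤ∣.∣ x ℤ.- + 1) ⊎ (+ p ℤ∣.∣ x ℤ.+ + 1)

  ≡±1-step : ∀ {p} x y → + p ℤ∣.∣ x ℤ.+ y → x ≡±1-mod p → y ≡±1-mod p
  ≡±1-step {p} x y p∣x+y (inj₁ p∣x-1) =
    inj₂ (ℤ∣.∣m+n∣m⇒∣n (subst (+ p ℤ∣.∣_) (split-minus x y) p∣x+y) p∣x-1)
    where
    split-minus : ∀ x y → x ℤ.+ y ≡ (x ℤ.- + 1) ℤ.+ (y ℤ.+ + 1)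
    split-minus = ℤ-Solver.solve-∀
  ≡±1-step {p} x y p∣x+y (inj₂ p∣x+1) =
    inj₁ (ℤ∣.∣m+n∣m⇒∣n (subst (+ p ℤ∣.∣_) (split-plus x y) p∣x+y) p∣x+1)
    where
    split-plus : ∀ x y → x ℤ.+ y ≡ (x ℤ.+ + 1) ℤ.+ (y ℤ.- + 1)
    split-plus = ℤ-Solver.solve-∀

  -- Every entry C(p^e − 1, m) of the row of p^e − 1 is ±1 modulo p, by
  -- induction on m: C(p^e − 1, 0) = 1, and consecutive entries sum to
  -- C(p^e, m + 1), which p divides.
  binomial-≡±1 : ∀ {p e n} → Prime p → suc n ≡ p ^ e → ∀ m → m ≤ n → + (n C m) ≡±1-mod p
  binomial-≡±1 pr n+1≡pᵉ zero _ = inj₁ (ℤ∣.divides (+ 0) refl)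
  binomial-≡±1 {p} {e} {n} pr n+1≡pᵉ (suc m) m<n =
    ≡±1-step (+ (n C m)) (+ (n C suc m))
      (ℤ∣.∣ᵤ⇒∣ (subst (p ∣_) (sym (nCk+nC[k+1]≡[n+1]C[k+1] n m)) (prime∣binomial {e = e} pr n+1≡pᵉ m<n)))
      (binomial-≡±1 {e = e} pr n+1≡pᵉ m (<⇒≤ m<n))

  binomℤ-≡±1 : ∀ {p e n k m} → Prime p → suc n ≡ p ^ e → k ≡ + m → m ≤ n → + binomℤ n k ≡±1-mod p
  binomℤ-≡±1 {p} {e} {n} pr n+1≡pᵉ k≡m m≤n =
    subst (λ k → + binomℤ n k ≡±1-mod p) (sym k≡m) (binomial-≡±1 {e = e} pr n+1≡pᵉ _ m≤n)

  infix 4 _≡1-mod_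
  _≡1-mod_ : ℕ → ℕ → Set
  x ≡1-mod a = ∃ λ q → x ≡ suc (q * a)

  ≡1-* : ∀ {a x y} → x ≡1-mod a → y ≡1-mod a → x * y ≡1-mod a
  ≡1-* {a} (q , refl) (r , refl) = r + q * suc (r * a) , expand q a r
    where
    expand : ∀ q a r → suc (q * a) * suc (r * a) ≡ suc ((r + q * suc (r * a)) * a)
    expand = solve-∀

  ≡1-^ : ∀ {a x} → x ≡1-mod a → ∀ t → x ^ t ≡1-mod a
  ≡1-^ x≡1 zero    = 0 , refl
  ≡1-^ x≡1 (suc t) = ≡1-* x≡1 (≡1-^ x≡1 t)

  %-≡⇒∣∸ : ∀ x y a .{{_ : NonZero a}} → x % a ≡ y % a → a ∣ y ∸ x
  %-≡⇒∣∸ x y a eq = divides (y / a ∸ x / a) (begin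
    y ∸ x                                          ≡⟨ cong₂ _∸_ (m≡m%n+[m/n]*n y a) (m≡m%n+[m/n]*n x a) ⟩
    (y % a + (y / a) * a) ∸ (x % a + (x / a) * a)  ≡⟨ cong (λ z → (y % a + (y / a) * a) ∸ (z + (x / a) * a)) eq ⟩
    (y % a + (y / a) * a) ∸ (y % a + (x / a) * a)  ≡⟨ [m+n]∸[m+o]≡n∸o (y % a) _ _ ⟩
    (y / a) * a ∸ (x / a) * a                      ≡⟨ sym (*-distribʳ-∸ a (y / a) (x / a)) ⟩
    (y / a ∸ x / a) * a                            ∎)
    where open ≡-Reasoning

  coprime-cancel-^ : ∀ {a x} → Coprime a x → ∀ i y → a ∣ x ^ i * y → a ∣ y
  coprime-cancel-^ {a} c zero    y a∣y = subst (a ∣_) (+-identityʳ y) a∣y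
  coprime-cancel-^ {a} {x} c (suc i) y a∣xⁱ⁺¹y =
    coprime-cancel-^ c i y (coprime-divisor c (subst (a ∣_) (*-assoc x (x ^ i) y) a∣xⁱ⁺¹y))

  prime∤⇒coprime : ∀ {a p} → Prime p → ¬ (p ∣ a) → Coprime a p
  prime∤⇒coprime pr p∤a (d∣a , d∣p) with prime⇒irreducible pr d∣p
  ... | inj₁ d≡1 = d≡1
  ... | inj₂ refl = ⊥-elim (p∤a d∣a)

  -- Some positive power of x is 1 modulo a, when x is coprime to a > 0.
  -- Two of the a + 1 powers x^0, …, x^a share a residue, say x^i and x^j with
  -- i < j; then a ∣ x^i·(x^(j−i) − 1), and the factor x^i cancels.
  multiplicative-order : ∀ {a x} .{{_ : NonZero a}} .{{_ : NonZero x}} → Coprime a x →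
    ∃ λ d → d > 0 × x ^ d ≡1-mod a
  multiplicative-order {a@(suc a-1)} {x} coprime
    with pigeonhole (n<1+n a) (λ (i : Fin (suc a)) → fromℕ< (m%n<n (x ^ toℕ i) a))
  ... | i , j , i<j , same-residue = d , m<n⇒0<n∸m i<j , quotient a∣xᵈ-1 , xᵈ≡1+qa
    where
    d = toℕ j ∸ toℕ i
    residues : x ^ toℕ i % a ≡ x ^ toℕ j % a
    residues = trans (sym (toℕ-fromℕ< (m%n<n (x ^ toℕ i) a)))
                     (trans (cong toℕ same-residue) (toℕ-fromℕ< (m%n<n (x ^ toℕ j) a)))
    difference : x ^ toℕ j ∸ x ^ toℕ i ≡ x ^ toℕ i * (x ^ d ∸ 1)
    difference = begin
      x ^ toℕ j ∸ x ^ toℕ i            ≡⟨ cong (λ k → x ^ k ∸ x ^ toℕ i) (sym (m+[n∸m]≡n (<⇒≤ i<j))) ⟩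
      x ^ (toℕ i + d) ∸ x ^ toℕ i      ≡⟨ cong₂ _∸_ (^-distribˡ-+-* x (toℕ i) d) (sym (*-identityʳ (x ^ toℕ i))) ⟩
      x ^ toℕ i * x ^ d ∸ x ^ toℕ i * 1 ≡⟨ sym (*-distribˡ-∸ (x ^ toℕ i) (x ^ d) 1) ⟩
      x ^ toℕ i * (x ^ d ∸ 1)          ∎
      where open ≡-Reasoning
    a∣xᵈ-1 : a ∣ x ^ d ∸ 1
    a∣xᵈ-1 = coprime-cancel-^ coprime (toℕ i) (x ^ d ∸ 1)
               (subst (a ∣_) difference (%-≡⇒∣∸ (x ^ toℕ i) (x ^ toℕ j) a residues))
    xᵈ≡1+qa : x ^ d ≡ suc (quotient a∣xᵈ-1 * a)
    xᵈ≡1+qa = trans (sym (m+[n∸m]≡n (m^n>0 x d))) (cong suc (m∣n⇒n≡quotient*m a∣xᵈ-1))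

  n<m^n : ∀ {m} → 1 < m → ∀ n → n < m ^ n
  n<m^n 1<m zero = s≤s z≤n
  n<m^n {m} 1<m (suc n) = begin-strict
    suc n               <⟨ s≤s (n<m^n 1<m n) ⟩
    1 + m ^ n           ≤⟨ +-monoˡ-≤ (m ^ n) (≤-trans (s≤s z≤n) (n<m^n 1<m n)) ⟩
    m ^ n + m ^ n       ≡⟨ cong (λ u → m ^ n + u) (sym (+-identityʳ (m ^ n))) ⟩
    2 * m ^ n           ≤⟨ *-monoˡ-≤ (m ^ n) 1<m ⟩
    m * m ^ n           ∎
    where open ≤-Reasoning

  -- For a prime p ∤ a, there are arbitrarily large n with a·n + 1 a power of p:
  -- take the exponent d·t with t = (M + 1)·a, where p^d ≡ 1 (mod a); then
  -- a·n + 1 = p^(dt) > dt ≥ (M + 1)·a forces n > M.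
  arbitrarily-large-prime-power : ∀ {a p} → a > 0 → Prime p → ¬ (p ∣ a) →
    ∀ M → ∃ λ n → ∃ λ e → M < n × suc (a * n) ≡ p ^ e
  arbitrarily-large-prime-power {a} {p} a>0 pr p∤a M
    with multiplicative-order {{>-nonZero a>0}} {{prime⇒nonZero pr}} (prime∤⇒coprime pr p∤a)
  ... | d , d>0 , pᵈ≡1
    with ≡1-^ pᵈ≡1 (suc M * a)
  ... | n , pᵈᵗ≡1+na = n , d * t , M<n , a*n+1≡pᵈᵗ
    where
    instance
      _ = >-nonZero a>0
      _ = >-nonZero d>0
    t = suc M * a
    a*n+1≡pᵈᵗ : suc (a * n) ≡ p ^ (d * t)
    a*n+1≡pᵈᵗ = trans (cong suc (*-comm a n)) (trans (sym pᵈᵗ≡1+na) (^-*-assoc p d t))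
    t≤na : t ≤ n * a
    t≤na = s≤s⁻¹ (subst (t <_) (trans (sym (^-*-assoc p d t)) pᵈᵗ≡1+na)
                   (≤-<-trans (m≤n*m t d) (n<m^n (nonTrivial⇒n>1 p {{prime⇒nonTrivial pr}}) (d * t))))
    M<n : M < n
    M<n = *-cancelʳ-≤ (suc M) n a t≤na

  shifted-index-in-row : ∀ {a b n} → b > 0 → a > b → ∀ β → ℤ.∣ β ∣ ≤ n →
    ∃ λ m → (+ (b * n)) ℤ.+ β ≡ + m × m ≤ a * n
  shifted-index-in-row {a} {b} {n} b>0 a>b (+ k) k≤n =
    b * n + k , refl , ≤-trans (+-monoʳ-≤ (b * n) k≤n) (subst (_≤ a * n) (+-comm n (b * n)) (*-monoˡ-≤ n a>b))
  shifted-index-in-row {a} {b} {n} b>0 a>b -[1+ k ] k<n =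
    b * n ∸ suc k , ⊖-≥ k<bn , ≤-trans (m∸n≤m (b * n) (suc k)) (*-monoˡ-≤ n (<⇒≤ a>b))
    where
    k<bn : suc k ≤ b * n
    k<bn = ≤-trans k<n (subst (_≤ b * n) (*-identityˡ n) (*-monoˡ-≤ n b>0))

open import Defs
open import Data.Nat using (ℕ; _>_; _*_)
open import Data.Nat.Primality using (Prime)
open import Data.Nat.Divisibility using (_∣_)
open import Data.Integer using (ℤ; +_; _+_; _-_)
open import Data.Integer.Divisibility using () renaming (_∣_ to _∣ℤ_)
open import Data.Product using (Σ; _×_)
open import Data.Sum using (_⊎_)
open import Relation.Nullary using (¬_)

import Data.Nat as ℕ
open import Data.Nat.Properties using (≤-<-trans; m≤m+n; m≤n+m; <⇒≤)
open import Data.Integer using (∣_∣)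
open import Data.Integer.Divisibility.Signed using (∣⇒∣ᵤ)
open import Data.Product using (_,_)
open import Data.Sum using (map)
open PrimePowerBinomials

-- Choose n > N + |β| with a·n + 1 = p^e; then b·n + β = m for some
-- 0 ≤ m ≤ a·n, and C(a·n, m) ≡ ±1 (mod p) as an entry of the row of p^e − 1.
theorem2p2 : (a b : ℕ) → a > 0 → b > 0 → a > b → (β : ℤ) → (p : ℕ) → Prime p → ¬ (p ∣ a) →
    (N : ℕ) → Σ ℕ λ n → (n > N) ×
    ((+ p ∣ℤ (+ binomℤ (a * n) ((+ (b * n)) + β) - + 1)) ⊎ (+ p ∣ℤ (+ binomℤ (a * n) ((+ (b * n)) + β) + + 1)))
theorem2p2 a b a>0 b>0 a>b β p pr p∤a N
  with arbitrarily-large-prime-power a>0 pr p∤a (N ℕ.+ ∣ β ∣)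
... | n , e , N+∣β∣<n , a*n+1≡pᵉ
  with shifted-index-in-row b>0 a>b β (<⇒≤ (≤-<-trans (m≤n+m ∣ β ∣ N) N+∣β∣<n))
... | m , bn+β≡m , m≤an =
  n , ≤-<-trans (m≤m+n N ∣ β ∣) N+∣β∣<n , map ∣⇒∣ᵤ ∣⇒∣ᵤ (binomℤ-≡±1 {e = e} pr a*n+1≡pᵉ bn+β≡m m≤an)
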